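{- Let $n \ge 3$ and let $\vec p=(p_1,\dots,p_n)$ be a probability vector ($p_j\ge 0$, $\sum_{j=1}^n p_j=1$). Suppose $n-1$ players independently each choose a number in $\{1,\dots,n\}$, choosing $j$ with probability $p_j$. For $i\in\{1,\dots,n\}$ let $c_i(\vec p)$ be the probability that no number in $\{1,\dots,i-1\}$ is chosen by exactly one of these $n-1$ players and no player chooses $i$. Regard $p_1,\dots,p_n$ as independent formal variables, set $Z_0=\left(\sum_{j=1}^n p_j\right)^{n-1}$, and for a polynomial $Q$ in $p_1,\dots,p_n$ define $E_j[Q]=Q|_{p_j=0}$, $D_j[Q]=\partial Q/\partial p_j$, and $L_j[Q]=p_j\,E_j[D_j[Q]]$. Then $c_i(\vec p)$ equals the polynomial $$\left\{\prod_{j=1}^{i-1}(1-L_j)\right\}\cdot E_i[Z_0],$$ evaluated at $\vec p$ (after which the normalization $\sum_j p_j=1$ may be used). Equivalently, defining $Z_i=Z_{i-1}-p_i\,E_i[D_i[Z_{i-1}]]$ recursively, $c_i(\vec p)=E_i[Z_{i-1}]$ evaluated at $\vec p$.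
   Context: This is the lowest unique positive integer (LUPI) game with $n$ players: each player chooses an integer from $1$ to $n$, and the player who chose the lowest number chosen by exactly one player wins. $c_i(\vec p)$ is the probability that the $n$th player wins by choosing $i$ when the other $n-1$ players all use the mixed strategy $\vec p$. The operators act on polynomials in $p_1,\dots,p_n$ viewed as independent variables; $L_j$ extracts the part of a polynomial that is exactly linear in $p_j$.
   Formalization: The probability vector $\vec p$ has rational entries. -}

module Defs where

open import Data.Nat as ℕ using (ℕ; zero; suc; _∸_; _≡ᵇ_; _<ᵇ_)
open import Data.Integer as ℤ using (ℤ; +_)
open import Data.Rational as ℚ using (ℚ; 0ℚ; 1ℚ)
open import Data.Fin using (Fin; toℕ)
open import Data.Bool using (Bool; true; false; _∧_; not; if_then_else_)
open import Data.List as List using (List; []; _∷_; _++_; map; concatMap; filterᵇ; foldr; take; length; allFin)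
open import Data.Vec as Vec using (Vec; lookup; updateAt; zipWith; replicate)
open import Data.Product using (_×_; _,_)
open import Relation.Binary.PropositionalEquality using (_≡_)

-- Probabilistic side.  Numbers 1..n are represented by Fin n
-- (number k+1 ↔ index k).  An outcome of the n-1 players is a
-- Vec (Fin n) (n ∸ 1).

outcomes : (m n : ℕ) → List (Vec (Fin n) m)
outcomes zero    n = Vec.[] ∷ []
outcomes (suc m) n = concatMap (λ v → map (λ x → x Vec.∷ v) (allFin n)) (outcomes m n)

sumℚ : List ℚ → ℚ
sumℚ = foldr ℚ._+_ 0ℚ

prodℚ : List ℚ → ℚ
prodℚ = foldr ℚ._*_ 1ℚ

weight : ∀ {m n} → (Fin n → ℚ) → Vec (Fin n) m → ℚ
weight p v = prodℚ (map p (Vec.toList v))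

count : ∀ {m n} → Fin n → Vec (Fin n) m → ℕ
count k v = length (filterᵇ (λ x → toℕ x ≡ᵇ toℕ k) (Vec.toList v))

event : ∀ {m n} → Fin n → Vec (Fin n) m → Bool
event {n = n} i v =
  foldr (λ k b → (not (toℕ k <ᵇ toℕ i) Data.Bool.∨ not (count k v ≡ᵇ 1)) ∧ b) true (allFin n)
  ∧ (count i v ≡ᵇ 0)

c : ∀ {n} → Fin n → (Fin n → ℚ) → ℚ
c {n} i p = sumℚ (map (weight p) (filterᵇ (event i) (outcomes (n ∸ 1) n)))

-- Formal polynomials in p_1..p_n with integer coefficients,
-- represented as lists of terms (coefficient, exponent vector).

Poly : ℕ → Set
Poly n = List (ℤ × Vec ℕ n)

constP : ∀ {n} → ℤ → Poly n
constP a = (a , replicate _ 0) ∷ []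

varP : ∀ {n} → Fin n → Poly n
varP j = (+ 1 , updateAt (replicate _ 0) j (λ _ → 1)) ∷ []

_+P_ : ∀ {n} → Poly n → Poly n → Poly n
_+P_ = _++_

negP : ∀ {n} → Poly n → Poly n
negP = map (λ { (a , e) → (ℤ.- a , e) })

_-P_ : ∀ {n} → Poly n → Poly n → Poly n
P -P Q = P +P negP Q

_*P_ : ∀ {n} → Poly n → Poly n → Poly n
P *P Q = concatMap (λ { (a , e) → map (λ { (b , f) → (a ℤ.* b , zipWith ℕ._+_ e f) }) Q }) P

_^P_ : ∀ {n} → Poly n → ℕ → Poly n
P ^P zero  = constP (+ 1)
P ^P suc k = P *P (P ^P k)

E : ∀ {n} → Fin n → Poly n → Poly n
E j = filterᵇ (λ { (a , e) → lookup e j ≡ᵇ 0 })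

D : ∀ {n} → Fin n → Poly n → Poly n
D j = map (λ { (a , e) → (a ℤ.* (+ lookup e j) , updateAt e j ℕ.pred) })

L : ∀ {n} → Fin n → Poly n → Poly n
L j Q = varP j *P E j (D j Q)

Z₀ : (n : ℕ) → Poly n
Z₀ n = foldr (λ j Q → varP j +P Q) [] (allFin n) ^P (n ∸ 1)

-- the indices j = 1, ..., i-1 (as Fin n: 0, ..., toℕ i - 1), in order
below : ∀ {n} → Fin n → List (Fin n)
below {n} i = take (toℕ i) (allFin n)

-- {∏_{j=1}^{i-1} (1 - L_j)} · Q, with j = 1 the outermost factor
prodOneMinusL : ∀ {n} → Fin n → Poly n → Poly n
prodOneMinusL i Q = foldr (λ j R → R -P L j R) Q (below i)

Z : (n : ℕ) → ℕ → Poly n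
Z n k = foldl' (take k (allFin n))
  where
  foldl' : List (Fin n) → Poly n
  foldl' js = List.foldl (λ R j → R -P (varP j *P E j (D j R))) (Z₀ n) js

powℚ : ℚ → ℕ → ℚ
powℚ x zero    = 1ℚ
powℚ x (suc k) = x ℚ.* powℚ x k

evalP : ∀ {n} → Poly n → (Fin n → ℚ) → ℚ
evalP {n} P p = sumℚ (map (λ { (a , e) → (a ℚ./ 1) ℚ.* prodℚ (map (λ k → powℚ (p k) (lookup e k)) (allFin n)) }) P)

IsProbVec : ∀ {n} → (Fin n → ℚ) → Set
IsProbVec {n} p = (∀ j → 0ℚ ℚ.≤ p j) × sumℚ (map p (allFin n)) ≡ 1ℚ

-- Evaluate a polynomial P against an arbitrary weight function g on
-- exponent vectors, ⟦ P ⟧ g = Σ a · g(e) over the terms a·p^e of P; with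
-- g e = p^e this is ordinary evaluation.  At this level the operators act by
-- restricting the weight:  E_i keeps the exponents with e_i = 0, L_j keeps
-- those with e_j = 1, hence 1 - L_j keeps those with e_j ≠ 1.  So both
-- ∏_{j<i} (1 - L_j) · E_i[Z₀] and E_i[Z_{i-1}] evaluate to Z₀ weighted by
-- p^e restricted to "no j < i has e_j = 1, and e_i = 0".  Finally the
-- multinomial expansion Z₀ = Σ over outcomes v of the n-1 players of p^(counts v)
-- identifies this with the probability of the event defining c_i.

module Submission where

open import Defs
open import Data.Nat as ℕ using (ℕ; zero; suc; _≥_; _∸_; _≡ᵇ_; _<ᵇ_)
open import Data.Integer as ℤ using (ℤ; +_; -[1+_])
open import Data.Rational as ℚ using (ℚ; 0ℚ; 1ℚ; mkℚ)
import Data.Rational.Properties as ℚP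
open import Data.Nat.Coprimality as Coprimality using (Coprime; 1-coprimeTo)
open import Data.Fin using (Fin; toℕ; zero; suc)
open import Data.Bool using (Bool; true; false; _∧_; _∨_; not; if_then_else_)
open import Data.List as List using (List; []; _∷_; _++_; map; concatMap; filterᵇ; foldr; take; allFin)
open import Data.List.Properties using (foldr-map; map-tabulate; take-map; map-cong; map-∘)
open import Data.Bool.ListAction using (and; all)
open import Data.Vec as Vec using (Vec; lookup; updateAt; zipWith; replicate)
open import Data.Vec.Properties using (lookup-replicate; lookup-zipWith; zipWith-replicate₁; map-id)
open import Data.Product using (_×_; _,_)
open import Algebra.Bundles using (CommutativeMonoid)
import Algebra.Properties.CommutativeSemigroup as CommSemigroupProperties
open import Algebra.Properties.Group ℚP.+-0-group using (//-rightDividesʳ)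
open import Algebra.Properties.CommutativeMonoid.Sum ℚP.*-1-commutativeMonoid
  using (sum-cong-≗; ∑-distrib-+; sum-replicate-zero)
  renaming (sum to ∏)
open import Relation.Binary.PropositionalEquality
open ≡-Reasoning

open CommSemigroupProperties (CommutativeMonoid.commutativeSemigroup ℚP.+-0-commutativeMonoid)
  using () renaming (interchange to +-interchange)

ι : ℤ → ℚ
ι a = a ℚ./ 1

coprimeTo1 : ∀ a → Coprime ℤ.∣ a ∣ 1
coprimeTo1 a = Coprimality.sym (1-coprimeTo ℤ.∣ a ∣)

-- ι a is the normal form a/1, on which ℚ multiplication and negation compute.
ι-normal : ∀ a → ι a ≡ mkℚ a 0 (coprimeTo1 a)
ι-normal (+ m)    = ℚP.normalize-coprime {m} (coprimeTo1 (+ m))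
ι-normal -[1+ m ] = cong ℚ.-_ (ℚP.normalize-coprime {suc m} (coprimeTo1 (+ suc m)))

ι-* : ∀ a b → ι (a ℤ.* b) ≡ ι a ℚ.* ι b
ι-* a b = cong₂ ℚ._*_ (sym (ι-normal a)) (sym (ι-normal b))

ι-neg : ∀ a → ι (ℤ.- a) ≡ ℚ.- ι a
ι-neg a = trans (ι-normal (ℤ.- a)) (trans (on-normal a) (cong ℚ.-_ (sym (ι-normal a))))
  where
  on-normal : ∀ a → mkℚ (ℤ.- a) 0 (coprimeTo1 (ℤ.- a)) ≡ ℚ.- mkℚ a 0 (coprimeTo1 a)
  on-normal (+ zero)  = refl
  on-normal (+ suc m) = refl
  on-normal -[1+ m ]  = refl

sumOver : ∀ {A : Set} → (A → ℚ) → List A → ℚ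
sumOver f xs = sumℚ (map f xs)

sumOver-cong : ∀ {A : Set} {f g : A → ℚ} → (∀ x → f x ≡ g x) → ∀ xs → sumOver f xs ≡ sumOver g xs
sumOver-cong eq []       = refl
sumOver-cong eq (x ∷ xs) = cong₂ ℚ._+_ (eq x) (sumOver-cong eq xs)

sumOver-++ : ∀ {A : Set} (f : A → ℚ) xs ys → sumOver f (xs ++ ys) ≡ sumOver f xs ℚ.+ sumOver f ys
sumOver-++ f []       ys = sym (ℚP.+-identityˡ _)
sumOver-++ f (x ∷ xs) ys =
  trans (cong (f x ℚ.+_) (sumOver-++ f xs ys)) (sym (ℚP.+-assoc (f x) (sumOver f xs) (sumOver f ys)))

sumOver-map : ∀ {A B : Set} (f : B → ℚ) (g : A → B) xs → sumOver f (map g xs) ≡ sumOver (λ x → f (g x)) xs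
sumOver-map f g []       = refl
sumOver-map f g (x ∷ xs) = cong (f (g x) ℚ.+_) (sumOver-map f g xs)

sumOver-concatMap : ∀ {A B : Set} (f : B → ℚ) (g : A → List B) xs →
  sumOver f (concatMap g xs) ≡ sumOver (λ x → sumOver f (g x)) xs
sumOver-concatMap f g []       = refl
sumOver-concatMap f g (x ∷ xs) =
  trans (sumOver-++ f (g x) (concatMap g xs)) (cong (sumOver f (g x) ℚ.+_) (sumOver-concatMap f g xs))

sumOver-+ : ∀ {A : Set} (f g : A → ℚ) xs → sumOver (λ x → f x ℚ.+ g x) xs ≡ sumOver f xs ℚ.+ sumOver g xs
sumOver-+ f g []       = sym (ℚP.+-identityˡ _)
sumOver-+ f g (x ∷ xs) =
  trans (cong ((f x ℚ.+ g x) ℚ.+_) (sumOver-+ f g xs)) (+-interchange (f x) (g x) (sumOver f xs) (sumOver g xs))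

sumOver-zero : ∀ {A : Set} (xs : List A) → sumOver (λ _ → 0ℚ) xs ≡ 0ℚ
sumOver-zero []       = refl
sumOver-zero (x ∷ xs) = trans (ℚP.+-identityˡ _) (sumOver-zero xs)

sumOver-swap : ∀ {A B : Set} (f : A → B → ℚ) xs ys →
  sumOver (λ x → sumOver (f x) ys) xs ≡ sumOver (λ y → sumOver (λ x → f x y) xs) ys
sumOver-swap f []       ys = sym (sumOver-zero ys)
sumOver-swap f (x ∷ xs) ys =
  trans (cong (sumOver (f x) ys ℚ.+_) (sumOver-swap f xs ys)) (sym (sumOver-+ (f x) (λ y → sumOver (λ x → f x y) xs) ys))

when : Bool → ℚ → ℚ
when b x = if b then x else 0ℚ

sumOver-filter : ∀ {A : Set} (f : A → ℚ) (P : A → Bool) xs →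
  sumOver f (filterᵇ P xs) ≡ sumOver (λ x → when (P x) (f x)) xs
sumOver-filter f P [] = refl
sumOver-filter f P (x ∷ xs) with P x
... | true  = cong (f x ℚ.+_) (sumOver-filter f P xs)
... | false = trans (sumOver-filter f P xs) (sym (ℚP.+-identityˡ _))

when-∧ : ∀ a b x → when a (when b x) ≡ when (a ∧ b) x
when-∧ true  b x = refl
when-∧ false b x = refl

when-∧-swap : ∀ a b x → when b (when a x) ≡ when (a ∧ b) x
when-∧-swap true  b     x = refl
when-∧-swap false true  x = refl
when-∧-swap false false x = refl

when-split : ∀ b x → x ≡ when (not b) x ℚ.+ when b x
when-split true  x = sym (ℚP.+-identityˡ x)
when-split false x = sym (ℚP.+-identityʳ x)

-- Evaluating a polynomial against a weight on exponent vectors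

_⊕_ : ∀ {n} → Vec ℕ n → Vec ℕ n → Vec ℕ n
e ⊕ f = zipWith ℕ._+_ e f

unit : ∀ {n} → Fin n → Vec ℕ n
unit j = updateAt (replicate _ 0) j (λ _ → 1)

⟦_⟧_ : ∀ {n} → Poly n → (Vec ℕ n → ℚ) → ℚ
⟦ [] ⟧          g = 0ℚ
⟦ (a , e) ∷ P ⟧ g = ι a ℚ.* g e ℚ.+ ⟦ P ⟧ g

⟦⟧-cong : ∀ {n} {g h : Vec ℕ n → ℚ} → (∀ e → g e ≡ h e) → ∀ P → ⟦ P ⟧ g ≡ ⟦ P ⟧ h
⟦⟧-cong eq []            = refl
⟦⟧-cong eq ((a , e) ∷ P) = cong₂ (λ x y → ι a ℚ.* x ℚ.+ y) (eq e) (⟦⟧-cong eq P)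

⟦⟧-++ : ∀ {n} (g : Vec ℕ n → ℚ) P Q → ⟦ P ++ Q ⟧ g ≡ ⟦ P ⟧ g ℚ.+ ⟦ Q ⟧ g
⟦⟧-++ g []            Q = sym (ℚP.+-identityˡ _)
⟦⟧-++ g ((a , e) ∷ P) Q =
  trans (cong (ι a ℚ.* g e ℚ.+_) (⟦⟧-++ g P Q)) (sym (ℚP.+-assoc (ι a ℚ.* g e) (⟦ P ⟧ g) (⟦ Q ⟧ g)))

⟦⟧-neg : ∀ {n} (g : Vec ℕ n → ℚ) P → ⟦ negP P ⟧ g ≡ ℚ.- ⟦ P ⟧ g
⟦⟧-neg g []            = refl
⟦⟧-neg g ((a , e) ∷ P) = begin
  ι (ℤ.- a) ℚ.* g e ℚ.+ ⟦ negP P ⟧ g  ≡⟨ cong₂ (λ x y → x ℚ.* g e ℚ.+ y) (ι-neg a) (⟦⟧-neg g P) ⟩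
  ℚ.- ι a ℚ.* g e ℚ.+ ℚ.- ⟦ P ⟧ g     ≡⟨ cong (ℚ._+ ℚ.- ⟦ P ⟧ g) (sym (ℚP.neg-distribˡ-* (ι a) (g e))) ⟩
  ℚ.- (ι a ℚ.* g e) ℚ.+ ℚ.- ⟦ P ⟧ g   ≡⟨ sym (ℚP.neg-distrib-+ (ι a ℚ.* g e) (⟦ P ⟧ g)) ⟩
  ℚ.- (ι a ℚ.* g e ℚ.+ ⟦ P ⟧ g)       ∎

⟦⟧-minus : ∀ {n} (g : Vec ℕ n → ℚ) P Q → ⟦ P -P Q ⟧ g ≡ ⟦ P ⟧ g ℚ.- ⟦ Q ⟧ g
⟦⟧-minus g P Q = trans (⟦⟧-++ g P (negP Q)) (cong (⟦ P ⟧ g ℚ.+_) (⟦⟧-neg g Q))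

⟦⟧-+ : ∀ {n} (g h : Vec ℕ n → ℚ) P → ⟦ P ⟧ (λ e → g e ℚ.+ h e) ≡ ⟦ P ⟧ g ℚ.+ ⟦ P ⟧ h
⟦⟧-+ g h []            = sym (ℚP.+-identityˡ _)
⟦⟧-+ g h ((a , e) ∷ P) =
  trans (cong₂ ℚ._+_ (ℚP.*-distribˡ-+ (ι a) (g e) (h e)) (⟦⟧-+ g h P))
        (+-interchange (ι a ℚ.* g e) (ι a ℚ.* h e) (⟦ P ⟧ g) (⟦ P ⟧ h))

⟦⟧-term* : ∀ {n} (g : Vec ℕ n → ℚ) a e Q →
  ⟦ map (λ { (b , f) → (a ℤ.* b , e ⊕ f) }) Q ⟧ g ≡ ι a ℚ.* ⟦ Q ⟧ (λ f → g (e ⊕ f))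
⟦⟧-term* g a e []            = sym (ℚP.*-zeroʳ (ι a))
⟦⟧-term* {n} g a e ((b , f) ∷ Q) = begin
  ι (a ℤ.* b) ℚ.* g (e ⊕ f) ℚ.+ rest           ≡⟨ cong (λ x → x ℚ.* g (e ⊕ f) ℚ.+ rest) (ι-* a b) ⟩
  ι a ℚ.* ι b ℚ.* g (e ⊕ f) ℚ.+ rest           ≡⟨ cong₂ ℚ._+_ (ℚP.*-assoc (ι a) (ι b) (g (e ⊕ f))) (⟦⟧-term* g a e Q) ⟩
  ι a ℚ.* (ι b ℚ.* g (e ⊕ f)) ℚ.+ ι a ℚ.* ⟦ Q ⟧ g′ ≡⟨ sym (ℚP.*-distribˡ-+ (ι a) _ _) ⟩
  ι a ℚ.* (ι b ℚ.* g (e ⊕ f) ℚ.+ ⟦ Q ⟧ g′)     ∎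
  where
  rest : ℚ
  rest = ⟦ map (λ { (b , f) → (a ℤ.* b , e ⊕ f) }) Q ⟧ g
  g′ : Vec ℕ n → ℚ
  g′ f = g (e ⊕ f)

⟦⟧-* : ∀ {n} (g : Vec ℕ n → ℚ) P Q → ⟦ P *P Q ⟧ g ≡ ⟦ P ⟧ (λ e → ⟦ Q ⟧ (λ f → g (e ⊕ f)))
⟦⟧-* g []            Q = refl
⟦⟧-* g ((a , e) ∷ P) Q =
  trans (⟦⟧-++ g (map (λ { (b , f) → (a ℤ.* b , e ⊕ f) }) Q) (P *P Q))
        (cong₂ ℚ._+_ (⟦⟧-term* g a e Q) (⟦⟧-* g P Q))

⟦⟧-E : ∀ {n} (g : Vec ℕ n → ℚ) j Q → ⟦ E j Q ⟧ g ≡ ⟦ Q ⟧ (λ e → when (lookup e j ≡ᵇ 0) (g e))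
⟦⟧-E g j [] = refl
⟦⟧-E g j ((a , e) ∷ Q) with lookup e j ≡ᵇ 0
... | true  = cong (ι a ℚ.* g e ℚ.+_) (⟦⟧-E g j Q)
... | false = trans (⟦⟧-E g j Q) (sym (trans (cong (ℚ._+ _) (ℚP.*-zeroʳ (ι a))) (ℚP.+-identityˡ _)))

⟦⟧-D : ∀ {n} (g : Vec ℕ n → ℚ) j Q →
  ⟦ D j Q ⟧ g ≡ ⟦ Q ⟧ (λ e → ι (+ lookup e j) ℚ.* g (updateAt e j ℕ.pred))
⟦⟧-D g j []            = refl
⟦⟧-D g j ((a , e) ∷ Q) = cong₂ ℚ._+_
  (trans (cong (ℚ._* g (updateAt e j ℕ.pred)) (ι-* a (+ lookup e j)))
         (ℚP.*-assoc (ι a) (ι (+ lookup e j)) (g (updateAt e j ℕ.pred))))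
  (⟦⟧-D g j Q)

⟦⟧-varP* : ∀ {n} (g : Vec ℕ n → ℚ) j Q → ⟦ varP j *P Q ⟧ g ≡ ⟦ Q ⟧ (λ f → g (unit j ⊕ f))
⟦⟧-varP* g j Q = trans (⟦⟧-* g (varP j) Q) (trans (ℚP.+-identityʳ _) (ℚP.*-identityˡ _))

unit-⊕-pred : ∀ {n} (e : Vec ℕ n) j → lookup e j ≡ 1 → unit j ⊕ updateAt e j ℕ.pred ≡ e
unit-⊕-pred (.1 Vec.∷ e) zero    refl = cong (1 Vec.∷_) (trans (zipWith-replicate₁ ℕ._+_ 0 e) (map-id e))
unit-⊕-pred (x Vec.∷ e)  (suc j) eq   = cong (x Vec.∷_) (unit-⊕-pred e j eq)

lookup-pred : ∀ {n} (e : Vec ℕ n) j → lookup (updateAt e j ℕ.pred) j ≡ ℕ.pred (lookup e j)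
lookup-pred (x Vec.∷ e) zero    = refl
lookup-pred (x Vec.∷ e) (suc j) = lookup-pred e j

-- L_j = p_j E_j D_j restricts the weight to exponents with e_j = 1: the factor
-- e_j from D_j vanishes for e_j = 0 and E_j kills e_j ≥ 2.
⟦⟧-L : ∀ {n} (g : Vec ℕ n → ℚ) j Q → ⟦ L j Q ⟧ g ≡ ⟦ Q ⟧ (λ e → when (lookup e j ≡ᵇ 1) (g e))
⟦⟧-L {n} g j Q = begin
  ⟦ L j Q ⟧ g                                        ≡⟨ ⟦⟧-varP* g j (E j (D j Q)) ⟩
  ⟦ E j (D j Q) ⟧ shifted                            ≡⟨ ⟦⟧-E shifted j (D j Q) ⟩
  ⟦ D j Q ⟧ (λ f → when (lookup f j ≡ᵇ 0) (shifted f)) ≡⟨ ⟦⟧-D _ j Q ⟩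
  ⟦ Q ⟧ (λ e → ι (+ lookup e j) ℚ.* when (lookup (lowered e) j ≡ᵇ 0) (shifted (lowered e)))
                                                     ≡⟨ ⟦⟧-cong pointwise Q ⟩
  ⟦ Q ⟧ (λ e → when (lookup e j ≡ᵇ 1) (g e))         ∎
  where
  shifted : Vec ℕ n → ℚ
  shifted f = g (unit j ⊕ f)
  lowered : Vec ℕ n → Vec ℕ n
  lowered e = updateAt e j ℕ.pred
  pointwise : ∀ e → ι (+ lookup e j) ℚ.* when (lookup (lowered e) j ≡ᵇ 0) (shifted (lowered e))
                  ≡ when (lookup e j ≡ᵇ 1) (g e)
  pointwise e rewrite lookup-pred e j with lookup e j in eⱼ
  ... | zero        = ℚP.*-zeroˡ (shifted (lowered e))
  ... | suc zero    = trans (ℚP.*-identityˡ (shifted (lowered e))) (cong g (unit-⊕-pred e j eⱼ))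
  ... | suc (suc k) = ℚP.*-zeroʳ (ι (+ suc (suc k)))

⟦⟧-1-L : ∀ {n} (g : Vec ℕ n → ℚ) j R → ⟦ R -P L j R ⟧ g ≡ ⟦ R ⟧ (λ e → when (not (lookup e j ≡ᵇ 1)) (g e))
⟦⟧-1-L {n} g j R = begin
  ⟦ R -P L j R ⟧ g                  ≡⟨ ⟦⟧-minus g R (L j R) ⟩
  ⟦ R ⟧ g ℚ.- ⟦ L j R ⟧ g            ≡⟨ cong₂ ℚ._-_ (⟦⟧-cong (λ e → when-split (lookup e j ≡ᵇ 1) (g e)) R) (⟦⟧-L g j R) ⟩
  ⟦ R ⟧ (λ e → other e ℚ.+ one e) ℚ.- ⟦ R ⟧ one ≡⟨ cong (ℚ._- ⟦ R ⟧ one) (⟦⟧-+ other one R) ⟩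
  ⟦ R ⟧ other ℚ.+ ⟦ R ⟧ one ℚ.- ⟦ R ⟧ one ≡⟨ //-rightDividesʳ (⟦ R ⟧ one) (⟦ R ⟧ other) ⟩
  ⟦ R ⟧ other                       ∎
  where
  one other : Vec ℕ n → ℚ
  one e   = when (lookup e j ≡ᵇ 1) (g e)
  other e = when (not (lookup e j ≡ᵇ 1)) (g e)

noUniqueAmong : ∀ {n} → List (Fin n) → Vec ℕ n → Bool
noUniqueAmong js e = all (λ j → not (lookup e j ≡ᵇ 1)) js

⟦⟧-∏1-L : ∀ {n} (js : List (Fin n)) g Q →
  ⟦ foldr (λ j R → R -P L j R) Q js ⟧ g ≡ ⟦ Q ⟧ (λ e → when (noUniqueAmong js e) (g e))
⟦⟧-∏1-L []       g Q = refl
⟦⟧-∏1-L {n} (j ∷ js) g Q = begin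
  ⟦ R -P L j R ⟧ g                                ≡⟨ ⟦⟧-1-L g j R ⟩
  ⟦ R ⟧ (λ e → when (not (lookup e j ≡ᵇ 1)) (g e)) ≡⟨ ⟦⟧-∏1-L js _ Q ⟩
  ⟦ Q ⟧ (λ e → when (noUniqueAmong js e) (when (not (lookup e j ≡ᵇ 1)) (g e)))
                                                  ≡⟨ ⟦⟧-cong (λ e → when-∧-swap _ (noUniqueAmong js e) (g e)) Q ⟩
  ⟦ Q ⟧ (λ e → when (noUniqueAmong (j ∷ js) e) (g e)) ∎
  where
  R : Poly n
  R = foldr (λ j R → R -P L j R) Q js

⟦⟧-Zsteps : ∀ {n} (js : List (Fin n)) g R →
  ⟦ List.foldl (λ R j → R -P (varP j *P E j (D j R))) R js ⟧ g ≡ ⟦ R ⟧ (λ e → when (noUniqueAmong js e) (g e))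
⟦⟧-Zsteps []       g R = refl
⟦⟧-Zsteps (j ∷ js) g R = begin
  ⟦ List.foldl _ (R -P L j R) js ⟧ g                         ≡⟨ ⟦⟧-Zsteps js g (R -P L j R) ⟩
  ⟦ R -P L j R ⟧ (λ e → when (noUniqueAmong js e) (g e))    ≡⟨ ⟦⟧-1-L _ j R ⟩
  ⟦ R ⟧ (λ e → when (not (lookup e j ≡ᵇ 1)) (when (noUniqueAmong js e) (g e)))
                                                            ≡⟨ ⟦⟧-cong (λ e → when-∧ _ (noUniqueAmong js e) (g e)) R ⟩
  ⟦ R ⟧ (λ e → when (noUniqueAmong (j ∷ js) e) (g e))       ∎

-- Multinomial expansion of Z₀

counts : ∀ {m n} → Vec (Fin n) m → Vec ℕ n
counts Vec.[]      = replicate _ 0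
counts (x Vec.∷ v) = unit x ⊕ counts v

linearForm : ∀ n → Poly n
linearForm n = foldr (λ j Q → varP j +P Q) [] (allFin n)

⟦⟧-linearForm : ∀ {n} (g : Vec ℕ n → ℚ) js →
  ⟦ foldr (λ j Q → varP j +P Q) [] js ⟧ g ≡ sumOver (λ j → g (unit j)) js
⟦⟧-linearForm g []       = refl
⟦⟧-linearForm g (j ∷ js) = cong₂ ℚ._+_ (ℚP.*-identityˡ (g (unit j))) (⟦⟧-linearForm g js)

multinomial : ∀ n m (g : Vec ℕ n → ℚ) → ⟦ linearForm n ^P m ⟧ g ≡ sumOver (λ v → g (counts v)) (outcomes m n)
multinomial n zero    g = cong (ℚ._+ 0ℚ) (ℚP.*-identityˡ (g (replicate n 0)))
multinomial n (suc m) g = begin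
  ⟦ linearForm n *P (linearForm n ^P m) ⟧ g                  ≡⟨ ⟦⟧-* g (linearForm n) (linearForm n ^P m) ⟩
  ⟦ linearForm n ⟧ (λ e → ⟦ linearForm n ^P m ⟧ (λ f → g (e ⊕ f))) ≡⟨ ⟦⟧-linearForm _ (allFin n) ⟩
  sumOver (λ j → ⟦ linearForm n ^P m ⟧ (λ f → g (unit j ⊕ f))) (allFin n)
    ≡⟨ sumOver-cong (λ j → multinomial n m (λ f → g (unit j ⊕ f))) (allFin n) ⟩
  sumOver (λ j → sumOver (λ v → g (counts (j Vec.∷ v))) (outcomes m n)) (allFin n)
    ≡⟨ sumOver-swap (λ j v → g (counts (j Vec.∷ v))) (allFin n) (outcomes m n) ⟩
  sumOver (λ v → sumOver (λ j → g (counts (j Vec.∷ v))) (allFin n)) (outcomes m n)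
    ≡⟨ sumOver-cong (λ v → sym (sumOver-map (λ w → g (counts w)) (Vec._∷ v) (allFin n))) (outcomes m n) ⟩
  sumOver (λ v → sumOver (λ w → g (counts w)) (map (Vec._∷ v) (allFin n))) (outcomes m n)
    ≡⟨ sym (sumOver-concatMap (λ w → g (counts w)) (λ v → map (Vec._∷ v) (allFin n)) (outcomes m n)) ⟩
  sumOver (λ v → g (counts v)) (outcomes (suc m) n) ∎

monomial : ∀ {n} → (Fin n → ℚ) → Vec ℕ n → ℚ
monomial {n} p e = prodℚ (map (λ k → powℚ (p k) (lookup e k)) (allFin n))

evalP-⟦⟧ : ∀ {n} (P : Poly n) p → evalP P p ≡ ⟦ P ⟧ (monomial p)
evalP-⟦⟧ []            p = refl
evalP-⟦⟧ ((a , e) ∷ P) p = cong (ι a ℚ.* monomial p e ℚ.+_) (evalP-⟦⟧ P p)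

prodℚ-allFin : ∀ {n} (F : Fin n → ℚ) → prodℚ (map F (allFin n)) ≡ ∏ F
prodℚ-allFin {n} F = trans (cong prodℚ (map-tabulate (λ k → k) F)) (tabulated F)
  where
  tabulated : ∀ {n} (G : Fin n → ℚ) → prodℚ (List.tabulate G) ≡ ∏ G
  tabulated {zero}  G = refl
  tabulated {suc n} G = cong (G zero ℚ.*_) (tabulated (λ k → G (suc k)))

monomial-∏ : ∀ {n} (p : Fin n → ℚ) e → monomial p e ≡ ∏ (λ k → powℚ (p k) (lookup e k))
monomial-∏ p e = prodℚ-allFin (λ k → powℚ (p k) (lookup e k))

∏-single : ∀ {n} (x : Fin n) (F : Fin n → ℚ) → (∀ k → (toℕ x ≡ᵇ toℕ k) ≡ false → F k ≡ 1ℚ) → ∏ F ≡ F x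
∏-single {suc n} zero F ones = begin
  F zero ℚ.* ∏ (λ k → F (suc k)) ≡⟨ cong (F zero ℚ.*_) (sum-cong-≗ {n} (λ k → ones (suc k) refl)) ⟩
  F zero ℚ.* ∏ {n} (λ _ → 1ℚ)        ≡⟨ cong (F zero ℚ.*_) (sum-replicate-zero n) ⟩
  F zero ℚ.* 1ℚ                   ≡⟨ ℚP.*-identityʳ (F zero) ⟩
  F zero                          ∎
∏-single {suc n} (suc x) F ones =
  trans (cong (ℚ._* ∏ (λ k → F (suc k))) (ones zero refl))
        (trans (ℚP.*-identityˡ _) (∏-single x (λ k → F (suc k)) (λ k → ones (suc k))))

lookup-unit : ∀ {n} (x k : Fin n) → lookup (unit x) k ≡ (if toℕ x ≡ᵇ toℕ k then 1 else 0)
lookup-unit zero    zero    = refl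
lookup-unit zero    (suc k) = lookup-replicate k 0
lookup-unit (suc x) zero    = refl
lookup-unit (suc x) (suc k) = lookup-unit x k

≡ᵇ-refl : ∀ m → (m ≡ᵇ m) ≡ true
≡ᵇ-refl zero    = refl
≡ᵇ-refl (suc m) = ≡ᵇ-refl m

pow-+ : ∀ a m n → powℚ a (m ℕ.+ n) ≡ powℚ a m ℚ.* powℚ a n
pow-+ a zero    n = sym (ℚP.*-identityˡ _)
pow-+ a (suc m) n = trans (cong (a ℚ.*_) (pow-+ a m n)) (sym (ℚP.*-assoc a (powℚ a m) (powℚ a n)))

monomial-counts : ∀ {m n} (p : Fin n → ℚ) (v : Vec (Fin n) m) → monomial p (counts v) ≡ weight p v
monomial-counts {n = n} p Vec.[] = begin
  monomial p (replicate n 0)                     ≡⟨ monomial-∏ p (replicate n 0) ⟩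
  ∏ (λ k → powℚ (p k) (lookup (replicate n 0) k)) ≡⟨ sum-cong-≗ {n} (λ k → cong (powℚ (p k)) (lookup-replicate k 0)) ⟩
  ∏ {n} (λ _ → 1ℚ)                                    ≡⟨ sum-replicate-zero n ⟩
  1ℚ                                              ∎
monomial-counts {n = n} p (x Vec.∷ v) = begin
  monomial p (unit x ⊕ counts v)                    ≡⟨ monomial-∏ p (unit x ⊕ counts v) ⟩
  ∏ (λ k → powℚ (p k) (lookup (unit x ⊕ counts v) k))
    ≡⟨ sum-cong-≗ {n} (λ k → trans (cong (powℚ (p k)) (lookup-zipWith ℕ._+_ k (unit x) (counts v)))
                               (pow-+ (p k) (lookup (unit x) k) (lookup (counts v) k))) ⟩
  ∏ (λ k → powℚ (p k) (lookup (unit x) k) ℚ.* powℚ (p k) (lookup (counts v) k))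
    ≡⟨ ∑-distrib-+ (λ k → powℚ (p k) (lookup (unit x) k)) (λ k → powℚ (p k) (lookup (counts v) k)) ⟩
  ∏ (λ k → powℚ (p k) (lookup (unit x) k)) ℚ.* ∏ (λ k → powℚ (p k) (lookup (counts v) k))
    ≡⟨ cong₂ ℚ._*_ (trans (∏-single x _ off-x) at-x) (trans (sym (monomial-∏ p (counts v))) (monomial-counts p v)) ⟩
  p x ℚ.* weight p v                                ∎
  where
  off-x : ∀ k → (toℕ x ≡ᵇ toℕ k) ≡ false → powℚ (p k) (lookup (unit x) k) ≡ 1ℚ
  off-x k x≢k rewrite lookup-unit x k | x≢k = refl
  at-x : powℚ (p x) (lookup (unit x) x) ≡ p x
  at-x rewrite lookup-unit x x | ≡ᵇ-refl (toℕ x) = ℚP.*-identityʳ (p x)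

Z₀-restricted : ∀ n (p : Fin n → ℚ) (b : Vec ℕ n → Bool) →
  ⟦ Z₀ n ⟧ (λ e → when (b e) (monomial p e)) ≡ sumOver (λ v → when (b (counts v)) (weight p v)) (outcomes (n ∸ 1) n)
Z₀-restricted n p b =
  trans (multinomial n (n ∸ 1) _)
        (sumOver-cong (λ v → cong (when (b (counts v))) (monomial-counts p v)) (outcomes (n ∸ 1) n))

-- The winning event in terms of counts

lookup-counts : ∀ {m n} (v : Vec (Fin n) m) k → lookup (counts v) k ≡ count k v
lookup-counts Vec.[]      k = lookup-replicate k 0
lookup-counts (x Vec.∷ v) k = begin
  lookup (unit x ⊕ counts v) k            ≡⟨ lookup-zipWith ℕ._+_ k (unit x) (counts v) ⟩
  lookup (unit x) k ℕ.+ lookup (counts v) k ≡⟨ cong₂ ℕ._+_ (lookup-unit x k) (lookup-counts v k) ⟩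
  (if toℕ x ≡ᵇ toℕ k then 1 else 0) ℕ.+ count k v ≡⟨ count-cons ⟩
  count k (x Vec.∷ v)                      ∎
  where
  count-cons : (if toℕ x ≡ᵇ toℕ k then 1 else 0) ℕ.+ count k v ≡ count k (x Vec.∷ v)
  count-cons with toℕ x ≡ᵇ toℕ k
  ... | true  = refl
  ... | false = refl

guarded≡below : ∀ n (i : Fin n) (C : Fin n → Bool) →
  foldr (λ k b → (not (toℕ k <ᵇ toℕ i) ∨ C k) ∧ b) true (allFin n) ≡ all C (below i)
guarded≡below (suc n) zero C = vacuous (allFin (suc n))
  where
  vacuous : ∀ ks → foldr (λ k b → (not (toℕ k <ᵇ 0) ∨ C k) ∧ b) true ks ≡ true
  vacuous []       = refl
  vacuous (k ∷ ks) = vacuous ks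
guarded≡below (suc n) (suc i) C = begin
  foldr G true (zero ∷ List.tabulate suc)           ≡⟨ cong (λ ks → C zero ∧ foldr G true ks) (sym (map-tabulate (λ k → k) suc)) ⟩
  C zero ∧ foldr G true (map suc (allFin n))         ≡⟨ cong (C zero ∧_) (foldr-map G suc true (allFin n)) ⟩
  C zero ∧ foldr (λ k → G (suc k)) true (allFin n)    ≡⟨ cong (C zero ∧_) (guarded≡below n i (λ k → C (suc k))) ⟩
  C zero ∧ all (λ k → C (suc k)) (below i)            ≡⟨ cong (λ ks → C zero ∧ and ks) (map-∘ (below i)) ⟩
  C zero ∧ all C (map suc (below i))                   ≡⟨ cong (λ ks → C zero ∧ all C ks) (sym (take-map (toℕ i) (allFin n))) ⟩
  C zero ∧ all C (take (toℕ i) (map suc (allFin n)))    ≡⟨ cong (λ ks → C zero ∧ all C (take (toℕ i) ks)) (map-tabulate (λ k → k) suc) ⟩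
  all C (below (suc i))                                ∎
  where
  G : Fin (suc n) → Bool → Bool
  G k b = (not (toℕ k <ᵇ toℕ (suc i)) ∨ C k) ∧ b

winningCounts : ∀ {n} → Fin n → Vec ℕ n → Bool
winningCounts i e = noUniqueAmong (below i) e ∧ (lookup e i ≡ᵇ 0)

event≡winningCounts : ∀ {m n} (i : Fin n) (v : Vec (Fin n) m) → event i v ≡ winningCounts i (counts v)
event≡winningCounts {n = n} i v = cong₂ _∧_
  (trans (guarded≡below n i (λ k → not (count k v ≡ᵇ 1)))
         (cong and (map-cong (λ k → cong (λ z → not (z ≡ᵇ 1)) (sym (lookup-counts v k))) (below i))))
  (cong (_≡ᵇ 0) (sym (lookup-counts v i)))

c-as-Z₀ : ∀ n (i : Fin n) p → c i p ≡ ⟦ Z₀ n ⟧ (λ e → when (winningCounts i e) (monomial p e))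
c-as-Z₀ n i p = begin
  c i p                                                         ≡⟨ sumOver-filter (weight p) (event i) outs ⟩
  sumOver (λ v → when (event i v) (weight p v)) outs             ≡⟨ sumOver-cong (λ v → cong (λ b → when b (weight p v)) (event≡winningCounts i v)) outs ⟩
  sumOver (λ v → when (winningCounts i (counts v)) (weight p v)) outs ≡⟨ sym (Z₀-restricted n p (winningCounts i)) ⟩
  ⟦ Z₀ n ⟧ (λ e → when (winningCounts i e) (monomial p e))      ∎
  where
  outs : List (Vec (Fin n) (n ∸ 1))
  outs = outcomes (n ∸ 1) n

mainTheorem1 : (n : ℕ) → n ≥ 3 → (p : Fin n → ℚ) → IsProbVec p →
    (i : Fin n) →
      (c i p ≡ evalP (prodOneMinusL i (E i (Z₀ n))) p)
      × (c i p ≡ evalP (E i (Z n (toℕ i))) p)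
mainTheorem1 n _ p _ i = product-form , recursive-form
  where
  restricted : (Vec ℕ n → Bool) → Vec ℕ n → ℚ
  restricted b e = when (b e) (monomial p e)
  product-form : c i p ≡ evalP (prodOneMinusL i (E i (Z₀ n))) p
  product-form = sym (begin
    evalP (prodOneMinusL i (E i (Z₀ n))) p                 ≡⟨ evalP-⟦⟧ (prodOneMinusL i (E i (Z₀ n))) p ⟩
    ⟦ prodOneMinusL i (E i (Z₀ n)) ⟧ monomial p             ≡⟨ ⟦⟧-∏1-L (below i) _ (E i (Z₀ n)) ⟩
    ⟦ E i (Z₀ n) ⟧ restricted (noUniqueAmong (below i))     ≡⟨ ⟦⟧-E _ i (Z₀ n) ⟩
    ⟦ Z₀ n ⟧ (λ e → when (lookup e i ≡ᵇ 0) (restricted (noUniqueAmong (below i)) e))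
                    ≡⟨ ⟦⟧-cong (λ e → when-∧-swap (noUniqueAmong (below i) e) _ (monomial p e)) (Z₀ n) ⟩
    ⟦ Z₀ n ⟧ restricted (winningCounts i)                   ≡⟨ sym (c-as-Z₀ n i p) ⟩
    c i p                                                   ∎)
  recursive-form : c i p ≡ evalP (E i (Z n (toℕ i))) p
  recursive-form = sym (begin
    evalP (E i (Z n (toℕ i))) p                             ≡⟨ evalP-⟦⟧ (E i (Z n (toℕ i))) p ⟩
    ⟦ E i (Z n (toℕ i)) ⟧ monomial p                        ≡⟨ ⟦⟧-E _ i (Z n (toℕ i)) ⟩
    ⟦ Z n (toℕ i) ⟧ restricted (λ e → lookup e i ≡ᵇ 0)      ≡⟨ ⟦⟧-Zsteps (below i) _ (Z₀ n) ⟩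
    ⟦ Z₀ n ⟧ (λ e → when (noUniqueAmong (below i) e) (restricted (λ e → lookup e i ≡ᵇ 0) e))
                    ≡⟨ ⟦⟧-cong (λ e → when-∧ (noUniqueAmong (below i) e) _ (monomial p e)) (Z₀ n) ⟩
    ⟦ Z₀ n ⟧ restricted (winningCounts i)                   ≡⟨ sym (c-as-Z₀ n i p) ⟩
    c i p                                                   ∎)
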